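{- For all positive integers $m,n$ with $m\equiv 0 \pmod 5$ and $n\equiv 0\pmod 5$, $\lambda_1^1(C_m \times C_n)=4$.
   Context: For a graph $G$, an $L(1,1)$-labeling with labels in $\{0,1,\dots,p\}$ is a function $l:V(G)\to\{0,1,\dots,p\}$ such that $l(u)\neq l(v)$ whenever the distance $d(u,v)$ is $1$ or $2$. $\lambda_1^1(G)$ denotes the least $p$ for which $G$ admits such a labeling. $C_n$ denotes the cycle with $n$ vertices. The direct product $G\times H$ has vertex set $V(G)\times V(H)$, with $(x_1,x_2)$ adjacent to $(y_1,y_2)$ iff $x_1y_1\in E(G)$ and $x_2y_2\in E(H)$. -}

module Defs where

open import Data.Nat using (ℕ; zero; suc; _<_)
open import Data.Fin using (Fin; toℕ)
open import Data.Product using (Σ; _×_; ∃)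
open import Data.Sum using (_⊎_)
open import Relation.Binary.PropositionalEquality using (_≡_)
open import Relation.Nullary using (¬_)

record Graph : Set₁ where
  field
    V   : Set
    Adj : V → V → Set
open Graph public

CycSucc : (n : ℕ) → Fin n → Fin n → Set
CycSucc n i j = (suc (toℕ i) ≡ toℕ j) ⊎ ((suc (toℕ i) ≡ n) × (toℕ j ≡ 0))

Cycle : ℕ → Graph
Cycle n = record { V = Fin n ; Adj = λ i j → CycSucc n i j ⊎ CycSucc n j i }

_×ᵍ_ : Graph → Graph → Graph
G ×ᵍ H = record
  { V   = V G × V H
  ; Adj = λ x y → Adj G (Data.Product.proj₁ x) (Data.Product.proj₁ y)
                × Adj H (Data.Product.proj₂ x) (Data.Product.proj₂ y) }

Dist1or2 : (G : Graph) → V G → V G → Set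
Dist1or2 G u v = ¬ (u ≡ v) × (Adj G u v ⊎ Σ (V G) (λ w → Adj G u w × Adj G w v))

IsL11Labeling : (G : Graph) (p : ℕ) → (V G → Fin (suc p)) → Set
IsL11Labeling G p l = ∀ u v → Dist1or2 G u v → ¬ (l u ≡ l v)

HasL11Labeling : Graph → ℕ → Set
HasL11Labeling G p = Σ (V G → Fin (suc p)) (IsL11Labeling G p)

λ11≡ : Graph → ℕ → Set
λ11≡ G p = HasL11Labeling G p × (∀ q → q < p → ¬ HasL11Labeling G q)

-- Label vertex (i , j) of C_m × C_n by i + 2j mod 5; this is well defined around both cycles
-- because 5 divides m and n. Adjacent vertices differ by (±1 , ±1), changing the label by ±1 or ±3;
-- distinct vertices at distance 2 differ by (δ , ε) with δ , ε ∈ {0 , ±2}, changing it by ±2, ±4 or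
-- ±2 ± 4 — never by 0 mod 5. Conversely a vertex and its four neighbours are pairwise at distance
-- at most 2, so any L(1,1)-labeling needs five labels.
module Submission where

open import Defs
open import Data.Nat using (ℕ; zero; suc; _+_; _*_; _≤_; _<_; z≤n; s≤s; >-nonZero)
open import Data.Nat.Divisibility using (_∣_; divides; ∣⇒≤)
open import Data.Nat.DivMod using (_mod_)
import Data.Nat.Properties as ℕ
open import Data.Fin using (Fin; toℕ; fromℕ) renaming (zero to fzero; suc to fsuc)
open import Data.Fin.Properties using (toℕ-injective; toℕ<n; toℕ-fromℕ; pigeonhole; all?; <⇒≢; _≟_)
open import Data.Product using (Σ; _×_; _,_)
open import Data.Sum using (_⊎_; inj₁; inj₂; map₁)
open import Data.Empty using (⊥-elim)
open import Function using (_∘_)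
open import Function.Definitions using (Injective)
open import Relation.Binary.Definitions using (Symmetric)
open import Relation.Binary.PropositionalEquality using (_≡_; _≢_; refl; sym; trans; cong)
open import Relation.Nullary using (¬_; Dec; ¬?)
open import Relation.Nullary.Decidable using (from-yes; _⊎-dec_; _→-dec_)

Step : {A : Set} → (A → A) → A → A → Set
Step σ x y = y ≡ σ x ⊎ x ≡ σ y

step? : ∀ {n} (σ : Fin n → Fin n) (x y : Fin n) → Dec (Step σ x y)
step? σ x y = (y ≟ σ x) ⊎-dec (x ≟ σ y)

Cycle-symmetric : ∀ n → Symmetric (Adj (Cycle n))
Cycle-symmetric n (inj₁ p) = inj₂ p
Cycle-symmetric n (inj₂ p) = inj₁ p

×ᵍ-symmetric : ∀ G H → Symmetric (Adj G) → Symmetric (Adj H) → Symmetric (Adj (G ×ᵍ H))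
×ᵍ-symmetric G H symG symH (p , q) = symG p , symH q

pairwise-close⇒no-labeling : ∀ G {k q} → suc q < k → (vs : Fin k → V G) →
                             (∀ {i j} → i ≢ j → Dist1or2 G (vs i) (vs j)) → ¬ HasL11Labeling G q
pairwise-close⇒no-labeling G q<k vs close (l , valid)
  with i , j , i<j , same ← pigeonhole q<k (l ∘ vs) = valid _ _ (close (<⇒≢ i<j)) same

star-pairwise-close : ∀ G {d} → Symmetric (Adj G) → (vs : Fin (suc d) → V G) → Injective _≡_ _≡_ vs →
                      (∀ i → Adj G (vs fzero) (vs (fsuc i))) →
                      ∀ {i j} → i ≢ j → Dist1or2 G (vs i) (vs j)
star-pairwise-close G symm vs injective centre-adj {i} {j} i≢j = i≢j ∘ injective , path i j i≢j
  where
  path : ∀ i j → i ≢ j → Adj G (vs i) (vs j) ⊎ Σ (V G) λ w → Adj G (vs i) w × Adj G w (vs j)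
  path fzero    fzero    i≢j = ⊥-elim (i≢j refl)
  path fzero    (fsuc j) _   = inj₁ (centre-adj j)
  path (fsuc i) fzero    _   = inj₁ (symm (centre-adj i))
  path (fsuc i) (fsuc j) _   = inj₂ (vs fzero , symm (centre-adj i) , centre-adj j)

CycSucc-functional : ∀ {m} {k i i' : Fin m} → CycSucc m k i → CycSucc m k i' → i ≡ i'
CycSucc-functional (inj₁ e) (inj₁ e') = toℕ-injective (trans (sym e) e')
CycSucc-functional {i = i} (inj₁ e) (inj₂ (e' , _)) =
  ⊥-elim (ℕ.<-irrefl (trans (sym e) e') (toℕ<n i))
CycSucc-functional {i' = i'} (inj₂ (e , _)) (inj₁ e') =
  ⊥-elim (ℕ.<-irrefl (trans (sym e') e) (toℕ<n i'))
CycSucc-functional (inj₂ (_ , e)) (inj₂ (_ , e')) = toℕ-injective (trans e (sym e'))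

CycSucc-injective : ∀ {m} {i i' k : Fin m} → CycSucc m i k → CycSucc m i' k → i ≡ i'
CycSucc-injective (inj₁ e) (inj₁ e') = toℕ-injective (ℕ.suc-injective (trans e (sym e')))
CycSucc-injective (inj₁ e) (inj₂ (_ , e')) with () ← trans e e'
CycSucc-injective (inj₂ (_ , e)) (inj₁ e') with () ← trans e' e
CycSucc-injective (inj₂ (e , _)) (inj₂ (e' , _)) = toℕ-injective (ℕ.suc-injective (trans e (sym e')))

zero-adj-one : ∀ k → Adj (Cycle (suc (suc k))) fzero (fsuc fzero)
zero-adj-one k = inj₁ (inj₁ refl)

zero-adj-last : ∀ k → Adj (Cycle (suc k)) fzero (fromℕ k)
zero-adj-last k = inj₂ (inj₂ (cong suc (toℕ-fromℕ k) , refl))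

module CycleWalk {A : Set} (σ : A → A) (start : A) where

  walk : ℕ → A
  walk zero = start
  walk (suc n) = σ (walk n)

  module _ {m : ℕ} (closed : walk m ≡ start) where

    CycSucc⇒σ : ∀ {i j : Fin m} → CycSucc m i j → walk (toℕ j) ≡ σ (walk (toℕ i))
    CycSucc⇒σ (inj₁ e) = cong walk (sym e)
    CycSucc⇒σ (inj₂ (e , e')) = trans (cong walk e') (sym (trans (cong walk e) closed))

    adj⇒step : ∀ {i j : Fin m} → Adj (Cycle m) i j → Step σ (walk (toℕ i)) (walk (toℕ j))
    adj⇒step (inj₁ p) = inj₁ (CycSucc⇒σ p)
    adj⇒step (inj₂ p) = inj₂ (CycSucc⇒σ p)

    adj²⇒twoSteps : ∀ {i k i' : Fin m} → Adj (Cycle m) i k → Adj (Cycle m) k i' →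
                    i ≡ i' ⊎ Step (σ ∘ σ) (walk (toℕ i)) (walk (toℕ i'))
    adj²⇒twoSteps (inj₁ p) (inj₁ q) = inj₂ (inj₁ (trans (CycSucc⇒σ q) (cong σ (CycSucc⇒σ p))))
    adj²⇒twoSteps (inj₁ p) (inj₂ q) = inj₁ (CycSucc-injective p q)
    adj²⇒twoSteps (inj₂ p) (inj₁ q) = inj₁ (CycSucc-functional p q)
    adj²⇒twoSteps (inj₂ p) (inj₂ q) = inj₂ (inj₂ (trans (CycSucc⇒σ p) (cong σ (CycSucc⇒σ q))))

suc₅ : Fin 5 → Fin 5
suc₅ x = suc (toℕ x) mod 5

label : Fin 5 → Fin 5 → Fin 5
label x y = (toℕ x + 2 * toℕ y) mod 5

label-separates-steps : ∀ x x' y y' → Step suc₅ x x' → Step suc₅ y y' → label x y ≢ label x' y'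
label-separates-steps = from-yes (all? λ x → all? λ x' → all? λ y → all? λ y' →
  step? suc₅ x x' →-dec step? suc₅ y y' →-dec ¬? (label x y ≟ label x' y'))

label-separates-twoStepsˡ : ∀ x x' y y' → Step (suc₅ ∘ suc₅) x x' →
                            y ≡ y' ⊎ Step (suc₅ ∘ suc₅) y y' → label x y ≢ label x' y'
label-separates-twoStepsˡ = from-yes (all? λ x → all? λ x' → all? λ y → all? λ y' →
  step? (suc₅ ∘ suc₅) x x' →-dec ((y ≟ y') ⊎-dec step? (suc₅ ∘ suc₅) y y') →-dec
  ¬? (label x y ≟ label x' y'))

label-separates-twoStepsʳ : ∀ x y y' → Step (suc₅ ∘ suc₅) y y' → label x y ≢ label x y'
label-separates-twoStepsʳ = from-yes (all? λ x → all? λ y → all? λ y' →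
  step? (suc₅ ∘ suc₅) y y' →-dec ¬? (label x y ≟ label x y'))

open CycleWalk suc₅ fzero renaming (walk to residue)

suc₅-period : ∀ x → suc₅ (suc₅ (suc₅ (suc₅ (suc₅ x)))) ≡ x
suc₅-period = from-yes (all? λ x → suc₅ (suc₅ (suc₅ (suc₅ (suc₅ x)))) ≟ x)

residue-multiple : ∀ q → residue (q * 5) ≡ fzero
residue-multiple zero = refl
residue-multiple (suc q) = trans (suc₅-period (residue (q * 5))) (residue-multiple q)

C×C-labeling : ∀ {m n} → 5 ∣ m → 5 ∣ n → HasL11Labeling (Cycle m ×ᵍ Cycle n) 4
C×C-labeling {m} {n} (divides p refl) (divides q refl) = L , L-valid
  where
  L : Fin m × Fin n → Fin 5
  L (i , j) = label (residue (toℕ i)) (residue (toℕ j))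

  closedᵐ : residue m ≡ fzero
  closedᵐ = residue-multiple p

  closedⁿ : residue n ≡ fzero
  closedⁿ = residue-multiple q

  L-valid : IsL11Labeling (Cycle m ×ᵍ Cycle n) 4 L
  L-valid _ _ (_ , inj₁ (a , b)) =
    label-separates-steps _ _ _ _ (adj⇒step closedᵐ a) (adj⇒step closedⁿ b)
  L-valid (i , j) (i' , j') (u≢v , inj₂ (_ , (a , b) , (a' , b')))
    with adj²⇒twoSteps closedᵐ a a' | adj²⇒twoSteps closedⁿ b b'
  ... | inj₁ refl | inj₁ refl = λ _ → u≢v refl
  ... | inj₂ s | t = label-separates-twoStepsˡ _ _ _ _ s (map₁ (cong (residue ∘ toℕ) {j} {j'}) t)
  ... | inj₁ refl | inj₂ t = label-separates-twoStepsʳ (residue (toℕ i)) _ _ t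

module _ (a b : ℕ) where

  star : Fin 5 → Fin (3 + a) × Fin (3 + b)
  star fzero                             = fzero , fzero
  star (fsuc fzero)                      = fsuc fzero , fsuc fzero
  star (fsuc (fsuc fzero))               = fsuc fzero , fromℕ (2 + b)
  star (fsuc (fsuc (fsuc fzero)))        = fromℕ (2 + a) , fsuc fzero
  star (fsuc (fsuc (fsuc (fsuc fzero)))) = fromℕ (2 + a) , fromℕ (2 + b)

  -- Inverting star relies on the last vertex fromℕ (2 + a) being neither 0 nor 1.
  star-index : Fin (3 + a) × Fin (3 + b) → Fin 5
  star-index (fzero      , _)          = fzero
  star-index (fsuc fzero , fsuc fzero) = fsuc fzero
  star-index (fsuc fzero , _)          = fsuc (fsuc fzero)
  star-index (_          , fsuc fzero) = fsuc (fsuc (fsuc fzero))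
  star-index _                         = fsuc (fsuc (fsuc (fsuc fzero)))

  star-index-star : ∀ k → star-index (star k) ≡ k
  star-index-star fzero                             = refl
  star-index-star (fsuc fzero)                      = refl
  star-index-star (fsuc (fsuc fzero))               = refl
  star-index-star (fsuc (fsuc (fsuc fzero)))        = refl
  star-index-star (fsuc (fsuc (fsuc (fsuc fzero)))) = refl

  star-injective : Injective _≡_ _≡_ star
  star-injective {k} {k'} eq =
    trans (sym (star-index-star k)) (trans (cong star-index eq) (star-index-star k'))

  star-centre-adj : ∀ i → Adj (Cycle (3 + a) ×ᵍ Cycle (3 + b)) (star fzero) (star (fsuc i))
  star-centre-adj fzero                      = zero-adj-one (1 + a) , zero-adj-one (1 + b)
  star-centre-adj (fsuc fzero)               = zero-adj-one (1 + a) , zero-adj-last (2 + b)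
  star-centre-adj (fsuc (fsuc fzero))        = zero-adj-last (2 + a) , zero-adj-one (1 + b)
  star-centre-adj (fsuc (fsuc (fsuc fzero))) = zero-adj-last (2 + a) , zero-adj-last (2 + b)

C×C-no-labeling : ∀ {m n q} → 3 ≤ m → 3 ≤ n → q < 4 → ¬ HasL11Labeling (Cycle m ×ᵍ Cycle n) q
C×C-no-labeling {suc (suc (suc a))} {suc (suc (suc b))} (s≤s (s≤s (s≤s _))) (s≤s (s≤s (s≤s _))) q<4 =
  pairwise-close⇒no-labeling G (s≤s q<4) (star a b)
    (star-pairwise-close G G-symmetric (star a b) (star-injective a b) (star-centre-adj a b))
  where
  G : Graph
  G = Cycle (3 + a) ×ᵍ Cycle (3 + b)

  G-symmetric : Symmetric (Adj G)
  G-symmetric =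
    ×ᵍ-symmetric (Cycle (3 + a)) (Cycle (3 + b)) (Cycle-symmetric (3 + a)) (Cycle-symmetric (3 + b))

mainTheorem6 : (m n : ℕ) → 0 < m → 0 < n → 5 ∣ m → 5 ∣ n →
    λ11≡ (Cycle m ×ᵍ Cycle n) 4
mainTheorem6 m n 0<m 0<n 5∣m 5∣n =
  C×C-labeling 5∣m 5∣n , λ q q<4 → C×C-no-labeling (5∣⇒3≤ 0<m 5∣m) (5∣⇒3≤ 0<n 5∣n) q<4
  where
  5∣⇒3≤ : ∀ {k} → 0 < k → 5 ∣ k → 3 ≤ k
  5∣⇒3≤ 0<k 5∣k = ℕ.≤-trans (s≤s (s≤s (s≤s z≤n))) (∣⇒≤ {{>-nonZero 0<k}} 5∣k)
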